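{- Let $G=(V,E)$ be a graph with $V=\{v_1,\dots,v_n\}$, let $k$ be a positive integer, and let $G'$ be the graph constructed from $(G,k)$ as described in the context, with $k'=1+kn+\sum_{v\in V}k(\delta(v)+1)$. If $G'$ has a safe set of size $k'$, then $G$ has a dominating set of size $k$.
   Context: $\delta(v)$ is the degree of $v$ in $G$, $N[v]$ the closed neighborhood. A dominating set of $G$ is a set $K$ with $N[v]\cap K\neq\emptyset$ for all $v$. A non-empty set $S\subseteq V(H)$ is a safe set of a graph $H$ if no connected component $C$ of $H[S]$ is adjacent (joined by an edge) to a connected component $D$ of $H-S$ with $|C|<|D|$. Construction of $G'$: (1) For each $j\in[k]$ create a cycle ("line") $V^j$ on vertices $v^j_1,\dots,v^j_{n^2}$ in this cyclic order; for $a,b\in[n]$ the vertex $v^j_{(b-1)n+a}$ is called the copy of $v_a$ in the $b$-th block of line $j$. (2) For each $j\in[k]$ and $b\in[n]$ attach to $v^j_{(b-1)n+1}$ a set $B^j_b$ of $k'-n+1$ new pendant vertices. (3) For each $i\in[n]$ build a gadget $\hat D_i$: a central vertex $z^i$ with a set $W^i$ of $k'-k(\delta(v_i)+1)$ new pendant vertices; for each $j\in[k]$ an independent set $X^i_j=\{x^{i,j}_w : w\in N[v_i]\}$ and an independent set $Y^i_j=\{y^{i,j}_w: w\in N[v_i]\}$, with edges $x^{i,j}_w y^{i,j}_w$ and $z^i y^{i,j}_w$ for all $w$, and each $x=x^{i,j}_w$ gets a set $Q_x$ of $k'-1$ new pendant vertices. (4) For all $i\in[n]$, $j\in[k]$,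 $a$ with $v_a\in N[v_i]$, add the edge between $x^{i,j}_{v_a}$ and $v^j_{(i-1)n+a}$ (the copy of $v_a$ in the $i$-th block of line $j$). (5) Add a universal vertex $u$ adjacent to all other vertices. -}

module Defs where

open import Data.Nat using (ℕ; zero; suc; _+_; _*_; _∸_; _<_; _≤_)
open import Data.Fin using (Fin; toℕ; _≟_)
open import Data.Bool using (Bool; true; false; T; not; _∨_)
open import Data.Vec using (tabulate) renaming (sum to vsum)
open import Data.Fin.Subset using (Subset; ∣_∣; _∈_)
open import Data.Product using (Σ; ∃; ∃-syntax; _×_)
open import Data.Sum using (_⊎_)
open import Function.Bundles using (_↔_; _⇔_)
open import Relation.Nullary using (¬_; does)
open import Relation.Binary.PropositionalEquality using (_≡_)

-- The input graph G on vertices v_1..v_n, represented as Fin n with a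
-- Bool-valued adjacency matrix (assumed symmetric and irreflexive in
-- the statement).

Adjacency : ℕ → Set
Adjacency n = Fin n → Fin n → Bool

deg : {n : ℕ} → Adjacency n → Fin n → ℕ
deg adj i = ∣ tabulate (adj i) ∣

closedN : {n : ℕ} → Adjacency n → Fin n → Fin n → Bool
closedN adj i w = does (i ≟ w) ∨ adj i w

kPrime : (n k : ℕ) → Adjacency n → ℕ
kPrime n k adj = 1 + k * n + vsum (tabulate (λ i → k * suc (deg adj i)))

IsDominatingSet : {n : ℕ} → Adjacency n → Subset n → Set
IsDominatingSet {n} adj K = (v : Fin n) → ∃[ w ] (w ∈ K × T (closedN adj v w))

module GraphNotions {V : Set} (E : V → V → Set) where

  data Reach (P : V → Set) : V → V → Set where
    here : ∀ {a} → P a → Reach P a a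
    step : ∀ {a b c} → Reach P a b → E b c → P c → Reach P a c

  IsComponent : (V → Set) → (V → Bool) → Set
  IsComponent P C =
    (∃[ c ] T (C c)) ×
    ((c : V) → T (C c) → (v : V) → (T (C v) ⇔ Reach P c v))

  HasSize : (V → Bool) → ℕ → Set
  HasSize A m = Fin m ↔ Σ V (λ v → T (A v))

  Joined : (V → Bool) → (V → Bool) → Set
  Joined C D = ∃[ c ] ∃[ d ] (T (C c) × T (D d) × E c d)

  IsSafeSet : (V → Bool) → Set
  IsSafeSet S =
    (∃[ v ] T (S v)) ×
    ((C D : V → Bool) (c d : ℕ) →
      IsComponent (λ v → T (S v)) C →
      IsComponent (λ v → T (not (S v))) D →
      Joined C D → HasSize C c → HasSize D d → ¬ (c < d))

module Construction (n k : ℕ) (adj : Adjacency n) where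

  k' : ℕ
  k' = kPrime n k adj

  NB : Fin n → Fin n → Set
  NB i w = T (closedN adj i w)

  data V' : Set where
    -- line j, block b, copy of v_a : v^j_{(b-1)n+a}
    line  : (j : Fin k) (b a : Fin n) → V'
    -- pendant vertices B^j_b (k' - n + 1 of them)
    bpend : (j : Fin k) (b : Fin n) → Fin (k' ∸ n + 1) → V'
    zv    : (i : Fin n) → V'
    wpend : (i : Fin n) → Fin (k' ∸ k * suc (deg adj i)) → V'
    xv    : (i : Fin n) (j : Fin k) (w : Fin n) → NB i w → V'
    yv    : (i : Fin n) (j : Fin k) (w : Fin n) → NB i w → V'
    -- pendant vertices Q_x for x = x^{i,j}_w (k' - 1 of them)
    qpend : (i : Fin n) (j : Fin k) (w : Fin n) → NB i w → Fin (k' ∸ 1) → V'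
    uv    : V'

  -- 0-based position of the copy of v_a in block b on a line
  pos : Fin n → Fin n → ℕ
  pos b a = toℕ b * n + toℕ a

  -- p and q are consecutive on the cycle 0,1,...,n²-1 (q follows p)
  CycSucc : ℕ → ℕ → Set
  CycSucc p q = (suc p ≡ q) ⊎ (suc p ≡ n * n × q ≡ 0 × ¬ (p ≡ q))

  data E0 : V' → V' → Set where
    cyc   : ∀ j b a b' a' → CycSucc (pos b a) (pos b' a') →
            E0 (line j b a) (line j b' a')
    bE    : ∀ j b (first : Fin n) → toℕ first ≡ 0 → ∀ t →
            E0 (line j b first) (bpend j b t)
    wE    : ∀ i t → E0 (zv i) (wpend i t)
    xyE   : ∀ i j w (h : NB i w) → E0 (xv i j w h) (yv i j w h)
    zyE   : ∀ i j w (h : NB i w) → E0 (zv i) (yv i j w h)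
    xqE   : ∀ i j w (h : NB i w) t → E0 (xv i j w h) (qpend i j w h t)
    xlE   : ∀ i j w (h : NB i w) → E0 (xv i j w h) (line j i w)
    uE    : ∀ v → ¬ (v ≡ uv) → E0 uv v

  Edge : V' → V' → Set
  Edge a b = E0 a b ⊎ E0 b a

  open GraphNotions Edge public

-- Because u is adjacent to every vertex, a safe set S of size k′ contains u: otherwise G′ − S is connected,
-- and it has at least k′ + 2 vertices since G′ contains two disjoint units of k′ + 1 vertices each. So S is
-- connected and every component of G′ − S has at most k′ vertices. The regions (a block of a line with its
-- pendants B) and the units ({x, y} ∪ Q_x) are connected sets of k′ + 1 vertices, so each meets S; with {u}
-- they are k′ disjoint parts, hence S consists of exactly one vertex of each part, and z^i ∉ S. The
-- component of z^i then forces some y^{i,j}_w into S, hence x^{i,j}_w ∉ S, hence the copy of w in block i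
-- of line j is in S. Along a line the position of the S-vertex cannot increase from one block to the next
-- (the vertices between the two would form a component of size k′ + 1), so by cyclicity it is the same
-- vertex a_j in every block, and {a_j | j ∈ [k]} dominates G. If n ≤ k, V itself dominates; otherwise n ≥ 2.

module Submission where

open import Defs
open import Data.Nat using (ℕ; _≤_)
open import Data.Fin using (Fin)
open import Data.Bool using (Bool; false)
open import Data.Fin.Subset using (Subset; ∣_∣)
open import Data.Product using (∃-syntax; _×_)
open import Relation.Binary.PropositionalEquality using (_≡_)

open import Data.Nat
  using (zero; suc; _+_; _*_; _∸_; _<_; _≤?_; _≤′_; ≤′-reflexive; ≤′-step; z≤n; s≤s; s≤s⁻¹)
  renaming (_≟_ to _≟ℕ_)
open import Data.Nat.Properties hiding (_≟_)
open import Data.Fin using (zero; suc; toℕ; fromℕ<; splitAt; join; _≟_)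
open import Data.Fin.Properties
  using (0↔⊥; 1↔⊤; +↔⊎; *↔×; injective⇒≤; join-splitAt; toℕ-injective; toℕ-fromℕ<; toℕ<n; any?; all?; ¬∀⟶∃¬)
open import Data.Fin.Subset using (_∈_; ⁅_⁆; _∪_) renaming (⊥ to ∅; ⊤ to full)
open import Data.Fin.Subset.Properties using (∣p∣≤n; p⊂q⇒∣p∣<∣q∣; ∣⊥∣≡0; ∣⁅x⁆∣≡1; x∈⁅x⁆; x∈p∪q⁺; ∈⊤; ∣⊤∣≡n)
open import Data.Bool using (true; T; not; _∨_; _∧_)
open import Data.Bool.Properties using (T?; T-∨; T-∧; T-≡; T-irrelevant)
open import Data.Vec using ([]; _∷_; tabulate) renaming (sum to vsum)
open import Data.Vec.Properties using ([]=⇒lookup; lookup⇒[]=; lookup∘tabulate)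
open import Data.Product using (Σ; ∃; _,_; proj₁; proj₂; map₂)
open import Data.Sum using (_⊎_; inj₁; inj₂; [_,_]′; swap)
open import Data.Unit using (⊤; tt)
open import Data.Maybe using (Maybe; just; nothing)
open import Data.Maybe.Properties using (just-injective)
open import Data.Empty using (⊥; ⊥-elim)
open import Function using (_∘_; const)
open import Function.Bundles using (_↔_; _↣_; _⇔_; Inverse; Injection; Equivalence; mk↔ₛ′; mk↣; mk⇔)
open import Function.Definitions using (Injective)
open import Function.Properties.Inverse using (↔-refl; ↔-sym; ↔-trans; ↔⇒↣)
open import Function.Construct.Composition using (_↣-∘_)
open import Data.Sum.Function.Propositional using (_⊎-↔_)
open import Data.Product.Function.Dependent.Propositional using (Σ-↔)
open import Data.Product.Function.NonDependent.Propositional using (_×-↔_)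
open import Relation.Nullary using (¬_; Dec; yes; no; does)
open import Relation.Nullary.Decidable using (map′; isYes; toWitness; fromWitness; _×-dec_; _⊎-dec_; _→-dec_; ¬?)
open import Relation.Binary.PropositionalEquality using (_≢_; refl; sym; trans; cong; cong₂; subst; module ≡-Reasoning)

open Inverse using (to; from; strictlyInverseˡ)

Finite : Set → Set
Finite A = Σ ℕ λ m → Fin m ↔ A

Fin-finite : ∀ {n} → Finite (Fin n)
Fin-finite = _ , ↔-refl

⊤-finite : Finite ⊤
⊤-finite = 1 , 1↔⊤

T-finite : ∀ b → Finite (T b)
T-finite false = 0 , 0↔⊥
T-finite true = ⊤-finite

⊎-finite : ∀ {A B : Set} → Finite A → Finite B → Finite (A ⊎ B)
⊎-finite (a , eA) (b , eB) = a + b , ↔-trans +↔⊎ (eA ⊎-↔ eB)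

Σ-Fin-suc↔ : ∀ {n} {P : Fin (suc n) → Set} → (P zero ⊎ Σ (Fin n) (P ∘ suc)) ↔ Σ (Fin (suc n)) P
Σ-Fin-suc↔ {n} {P} = mk↔ₛ′ [ (zero ,_) , (λ (i , p) → suc i , p) ]′ split
  (λ { (zero , p) → refl ; (suc i , p) → refl }) (λ { (inj₁ p) → refl ; (inj₂ (i , p)) → refl })
  where
  split : Σ (Fin (suc n)) P → P zero ⊎ Σ (Fin n) (P ∘ suc)
  split (zero , p) = inj₁ p
  split (suc i , p) = inj₂ (i , p)

sum↔Σ : ∀ {n} (f : Fin n → ℕ) → Fin (vsum (tabulate f)) ↔ Σ (Fin n) (Fin ∘ f)
sum↔Σ {zero} f = mk↔ₛ′ (λ ()) (λ ()) (λ ()) (λ ())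
sum↔Σ {suc n} f = ↔-trans +↔⊎ (↔-trans (↔-refl ⊎-↔ sum↔Σ (f ∘ suc)) Σ-Fin-suc↔)

Σ-finite : ∀ {A : Set} {B : A → Set} → Finite A → (∀ a → Finite (B a)) → Finite (Σ A B)
Σ-finite (_ , eA) fB =
  _ , ↔-trans (sum↔Σ _) (↔-trans (Σ-↔ ↔-refl (proj₂ (fB (to eA _)))) (Σ-↔ eA ↔-refl))

∣tabulate∣≡ : ∀ {n} (q : Fin n → Bool) → ∣ tabulate q ∣ ≡ proj₁ (Σ-finite Fin-finite (T-finite ∘ q))
∣tabulate∣≡ {zero} q = refl
∣tabulate∣≡ {suc n} q with q zero
... | true = cong suc (∣tabulate∣≡ (q ∘ suc))
... | false = ∣tabulate∣≡ (q ∘ suc)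

count↔Σ : ∀ {n} (q : Fin n → Bool) → Fin ∣ tabulate q ∣ ↔ Σ (Fin n) (T ∘ q)
count↔Σ {n} q = subst (λ m → Fin m ↔ Σ (Fin n) (T ∘ q)) (sym (∣tabulate∣≡ q))
                      (proj₂ (Σ-finite Fin-finite (T-finite ∘ q)))

∣tabulate-insert∣ : ∀ {n} (i : Fin n) (q : Fin n → Bool) → q i ≡ false →
                    ∣ tabulate (λ w → does (i ≟ w) ∨ q w) ∣ ≡ suc ∣ tabulate q ∣
∣tabulate-insert∣ zero q qi rewrite qi = refl
∣tabulate-insert∣ (suc i) q qi with q zero
... | true = cong suc (∣tabulate-insert∣ i (q ∘ suc) qi)
... | false = ∣tabulate-insert∣ i (q ∘ suc) qi

∈-tabulate⁺ : ∀ {n} {f : Fin n → Bool} {i} → T (f i) → i ∈ tabulate f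
∈-tabulate⁺ {f = f} {i} fi = lookup⇒[]= i (tabulate f) (trans (lookup∘tabulate f i) (Equivalence.to T-≡ fi))

∈-tabulate⁻ : ∀ {n} {f : Fin n → Bool} {i} → i ∈ tabulate f → T (f i)
∈-tabulate⁻ {f = f} {i} i∈ = Equivalence.from T-≡ (trans (sym (lookup∘tabulate f i)) ([]=⇒lookup i∈))

∣p∪q∣≤∣p∣+∣q∣ : ∀ {n} (p q : Subset n) → ∣ p ∪ q ∣ ≤ ∣ p ∣ + ∣ q ∣
∣p∪q∣≤∣p∣+∣q∣ [] [] = z≤n
∣p∪q∣≤∣p∣+∣q∣ (true ∷ p) (true ∷ q) = s≤s (≤-trans (∣p∪q∣≤∣p∣+∣q∣ p q) (+-monoʳ-≤ ∣ p ∣ (n≤1+n _)))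
∣p∪q∣≤∣p∣+∣q∣ (true ∷ p) (false ∷ q) = s≤s (∣p∪q∣≤∣p∣+∣q∣ p q)
∣p∪q∣≤∣p∣+∣q∣ (false ∷ p) (true ∷ q) = subst (suc ∣ p ∪ q ∣ ≤_) (sym (+-suc ∣ p ∣ ∣ q ∣)) (s≤s (∣p∪q∣≤∣p∣+∣q∣ p q))
∣p∪q∣≤∣p∣+∣q∣ (false ∷ p) (false ∷ q) = ∣p∪q∣≤∣p∣+∣q∣ p q

image : ∀ {m n} → (Fin m → Fin n) → Subset n
image {zero} f = ∅
image {suc m} f = ⁅ f zero ⁆ ∪ image (f ∘ suc)

∈-image : ∀ {m n} (f : Fin m → Fin n) j → f j ∈ image f
∈-image f zero = x∈p∪q⁺ (inj₁ (x∈⁅x⁆ _))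
∈-image f (suc j) = x∈p∪q⁺ (inj₂ (∈-image (f ∘ suc) j))

∣image∣≤ : ∀ {m n} (f : Fin m → Fin n) → ∣ image f ∣ ≤ m
∣image∣≤ {zero} {n} f = ≤-reflexive (∣⊥∣≡0 n)
∣image∣≤ {suc m} f = begin
  ∣ ⁅ f zero ⁆ ∪ image (f ∘ suc) ∣       ≤⟨ ∣p∪q∣≤∣p∣+∣q∣ ⁅ f zero ⁆ (image (f ∘ suc)) ⟩
  ∣ ⁅ f zero ⁆ ∣ + ∣ image (f ∘ suc) ∣   ≡⟨ cong (_+ ∣ image (f ∘ suc) ∣) (∣⁅x⁆∣≡1 (f zero)) ⟩
  suc ∣ image (f ∘ suc) ∣                ≤⟨ s≤s (∣image∣≤ (f ∘ suc)) ⟩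
  suc m                                  ∎
  where open ≤-Reasoning

injection⇒≤ : ∀ {a b} {X Y : Set} → Fin a ↔ X → Fin b ↔ Y → X ↣ Y → a ≤ b
injection⇒≤ eX eY f = injective⇒≤ (Injection.injective (↔⇒↣ (↔-sym eY) ↣-∘ (f ↣-∘ ↔⇒↣ eX)))

injection-surjective : ∀ {m} {A X : Set} → Fin m ↔ A → Fin m ↔ X → (g : A → X) → Injective _≡_ _≡_ g →
                       ((x y : X) → Dec (x ≡ y)) → ∀ x → ∃ λ a → g a ≡ x
injection-surjective {m} eA eX g g-inj _≟X_ x with any? (λ i → g (to eA i) ≟X x)
... | yes (i , e) = to eA i , e
... | no x∉img = ⊥-elim (<-irrefl refl (injection⇒≤ (↔-trans (+↔⊎ {1}) (1↔⊤ ⊎-↔ eA)) eX (mk↣ inj)))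
  where
  missed : ∀ a → g a ≢ x
  missed a e = x∉img (from eA a , subst (λ a′ → g a′ ≡ x) (sym (strictlyInverseˡ eA a)) e)
  inj : Injective _≡_ _≡_ [ const x , g ]′
  inj {inj₁ _} {inj₁ _} _ = refl
  inj {inj₁ _} {inj₂ a} e = ⊥-elim (missed a (sym e))
  inj {inj₂ a} {inj₁ _} e = ⊥-elim (missed a e)
  inj {inj₂ a} {inj₂ b} e = cong inj₂ (g-inj e)

not-T⁺ : ∀ {b} → ¬ T b → T (not b)
not-T⁺ {false} _ = tt
not-T⁺ {true} ¬b = ¬b tt

not-T⁻ : ∀ {b} → T (not b) → ¬ T b
not-T⁻ {false} _ ()

module _ {V : Set} where

  Σ-T-≡ : ∀ {D : V → Bool} {v w} (p : T (D v)) (q : T (D w)) → v ≡ w → (v , p) ≡ (w , q)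
  Σ-T-≡ p q refl = cong (_ ,_) (T-irrelevant p q)

  Σ-T-≟ : ∀ {D : V → Bool} → ((v w : V) → Dec (v ≡ w)) → (x y : Σ V (T ∘ D)) → Dec (x ≡ y)
  Σ-T-≟ _≟V_ (v , p) (w , q) = map′ (Σ-T-≡ p q) (cong proj₁) (v ≟V w)

  subset-≤ : ∀ {D S : V → Bool} {d s} → Fin d ↔ Σ V (T ∘ D) → Fin s ↔ Σ V (T ∘ S) →
             (∀ v → T (D v) → T (S v)) → d ≤ s
  subset-≤ |D| |S| D⊆S = injection⇒≤ |D| |S| (mk↣ {to = λ (v , p) → v , D⊆S v p}
                                                    λ {x} {y} e → Σ-T-≡ (proj₂ x) (proj₂ y) (cong proj₁ e))

  module _ (S : V → Bool) where

    classify : V → Σ V (T ∘ S) ⊎ Σ V (T ∘ not ∘ S)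
    classify v with T? (S v)
    ... | yes v∈S = inj₁ (v , v∈S)
    ... | no v∉S = inj₂ (v , not-T⁺ v∉S)

    forget-classify : ∀ v → [ proj₁ , proj₁ ]′ (classify v) ≡ v
    forget-classify v with T? (S v)
    ... | yes _ = refl
    ... | no _ = refl

    ≤-partition : ∀ {N s d} → Fin N ↔ V → Fin s ↔ Σ V (T ∘ S) → Fin d ↔ Σ V (T ∘ not ∘ S) → N ≤ s + d
    ≤-partition enum |S| |∁S| = injection⇒≤ enum (↔-trans +↔⊎ (|S| ⊎-↔ |∁S|)) (mk↣ {to = classify} λ {x} {y} e →
      trans (sym (forget-classify x)) (trans (cong [ proj₁ , proj₁ ]′ e) (forget-classify y)))

term≤sum : ∀ {n} (f : Fin n → ℕ) i → f i ≤ vsum (tabulate f)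
term≤sum f zero = m≤m+n _ _
term≤sum f (suc i) = ≤-trans (term≤sum (f ∘ suc) i) (m≤n+m _ _)

module _ {A : Set} where

  infixr 5 _⊕_

  _⊕_ : ∀ {a b} → (Fin a → A) → (Fin b → A) → Fin (a + b) → A
  _⊕_ {a} g₁ g₂ i = [ g₁ , g₂ ]′ (splitAt a i)

  ⊕-all : ∀ {a b} (Q : A → Set) {g₁ : Fin a → A} {g₂ : Fin b → A} →
          (∀ i → Q (g₁ i)) → (∀ i → Q (g₂ i)) → ∀ i → Q ((g₁ ⊕ g₂) i)
  ⊕-all {a = a} Q q₁ q₂ i with splitAt a i
  ... | inj₁ i₁ = q₁ i₁
  ... | inj₂ i₂ = q₂ i₂

  ⊕-injective : ∀ {a b} {g₁ : Fin a → A} {g₂ : Fin b → A} → Injective _≡_ _≡_ g₁ → Injective _≡_ _≡_ g₂ →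
                (∀ i j → g₁ i ≢ g₂ j) → Injective _≡_ _≡_ (g₁ ⊕ g₂)
  ⊕-injective {a = a} {b} {g₁} {g₂} inj₁′ inj₂′ disjoint {x} {y} e =
    trans (sym (join-splitAt a b x)) (trans (from-split (splitAt a x) (splitAt a y) e) (join-splitAt a b y))
    where
    from-split : ∀ p q → [ g₁ , g₂ ]′ p ≡ [ g₁ , g₂ ]′ q → join a b p ≡ join a b q
    from-split (inj₁ p) (inj₁ q) e = cong (join a b ∘ inj₁) (inj₁′ e)
    from-split (inj₁ p) (inj₂ q) e = ⊥-elim (disjoint p q e)
    from-split (inj₂ p) (inj₁ q) e = ⊥-elim (disjoint q p (sym e))
    from-split (inj₂ p) (inj₂ q) e = cong (join a b ∘ inj₂) (inj₂′ e)

  single : A → Fin 1 → A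
  single v _ = v

  single-injective : ∀ v → Injective _≡_ _≡_ (single v)
  single-injective v {zero} {zero} _ = refl

¬[T⇒]⇒T×¬ : ∀ {b} {B : Set} → ¬ (T b → B) → T b × ¬ B
¬[T⇒]⇒T×¬ {true} h = tt , h ∘ const
¬[T⇒]⇒T×¬ {false} h = ⊥-elim (h λ ())

closedN-refl : ∀ {n} (adj : Adjacency n) i → T (closedN adj i i)
closedN-refl adj i with i ≟ i
... | yes _ = tt
... | no i≢i = ⊥-elim (i≢i refl)

module Reachability {V : Set} (E : V → V → Set) (E? : ∀ a b → Dec (E a b))
                    (E-sym : ∀ {a b} → E a b → E b a) {N : ℕ} (enum : Fin N ↔ V) where
  open GraphNotions E

  module _ {P : V → Set} where

    Reach-target : ∀ {a b} → Reach P a b → P b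
    Reach-target (here pb) = pb
    Reach-target (step _ _ pb) = pb

    Reach-cons : ∀ {x a b} → P x → E x a → Reach P a b → Reach P x b
    Reach-cons px e (here pa) = step (here px) e pa
    Reach-cons px e (step r e′ pc) = step (Reach-cons px e r) e′ pc

    Reach-sym : ∀ {a b} → Reach P a b → Reach P b a
    Reach-sym (here pa) = here pa
    Reach-sym (step r e pc) = Reach-cons pc (E-sym e) (Reach-sym r)

    Reach-trans : ∀ {a b c} → Reach P a b → Reach P b c → Reach P a c
    Reach-trans r (here _) = r
    Reach-trans r (step r′ e pc) = step (Reach-trans r r′) e pc

  _≟V_ : (a b : V) → Dec (a ≡ b)
  a ≟V b = map′ (Injection.injective (↔⇒↣ (↔-sym enum))) (cong (from enum)) (from enum a ≟ from enum b)

  any?V : ∀ {Q : V → Set} → (∀ v → Dec (Q v)) → Dec (∃ Q)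
  any?V {Q} Q? = map′ (λ (i , q) → to enum i , q)
                      (λ (v , q) → from enum v , subst Q (sym (strictlyInverseˡ enum v)) q)
                      (any? (Q? ∘ to enum))

  size : (V → Bool) → ℕ
  size R = ∣ tabulate (R ∘ to enum) ∣

  -- The vertices reachable from c inside p are computed as the least fixed point of `grow`;
  -- it is reached after N steps because every non-final step adds a vertex.
  module Search (p : V → Bool) (c : V) where

    Adjacent? : (R : V → Bool) (w : V) → Dec (∃ λ x → T (R x) × E x w)
    Adjacent? R w = any?V (λ x → T? (R x) ×-dec E? x w)

    grow : (V → Bool) → V → Bool
    grow R w = R w ∨ (p w ∧ isYes (Adjacent? R w))

    reached : ℕ → V → Bool
    reached zero w = p w ∧ isYes (c ≟V w)
    reached (suc t) = grow (reached t)

    reached-sound : ∀ t w → T (reached t w) → Reach (T ∘ p) c w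
    reached-sound zero w r with c ≟V w | Equivalence.to (T-∧ {p w}) r
    ... | yes refl | pw , _ = here pw
    ... | no _ | _ , ()
    reached-sound (suc t) w r with Equivalence.to (T-∨ {reached t w}) r
    ... | inj₁ r′ = reached-sound t w r′
    ... | inj₂ r′ with Equivalence.to (T-∧ {p w}) r′
    ... | pw , adj with toWitness adj
    ... | x , rx , e = step (reached-sound t x rx) e pw

    grow-⊇ : ∀ R w → T (R w) → T (grow R w)
    grow-⊇ R w r = Equivalence.from T-∨ (inj₁ r)

    grow-mono : ∀ R R′ → (∀ w → T (R w) → T (R′ w)) → ∀ w → T (grow R w) → T (grow R′ w)
    grow-mono R R′ R⊆R′ w g with Equivalence.to (T-∨ {R w}) g
    ... | inj₁ r = grow-⊇ R′ w (R⊆R′ w r)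
    ... | inj₂ g′ with Equivalence.to (T-∧ {p w}) g′
    ... | pw , adj with toWitness adj
    ... | x , rx , e = Equivalence.from (T-∨ {R′ w})
          (inj₂ (Equivalence.from T-∧ (pw , fromWitness (x , R⊆R′ x rx , e))))

    Closed : (V → Bool) → Set
    Closed R = ∀ w → T (grow R w) → T (R w)

    grow-closed : ∀ {R} → Closed R → Closed (grow R)
    grow-closed {R} cl = grow-mono (grow R) R cl

    closed-or-grows : ∀ R → Closed R ⊎ size R < size (grow R)
    closed-or-grows R with all? (λ i → T? (grow R (to enum i)) →-dec T? (R (to enum i)))
    ... | yes cl = inj₁ λ w g → subst (T ∘ R) (strictlyInverseˡ enum w)
                                  (cl (from enum w) (subst (T ∘ grow R) (sym (strictlyInverseˡ enum w)) g))
    ... | no ¬cl with ¬∀⟶∃¬ N _ (λ i → T? (grow R (to enum i)) →-dec T? (R (to enum i))) ¬cl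
    ... | i , ¬cl-i with ¬[T⇒]⇒T×¬ ¬cl-i
    ... | g , ¬r = inj₂ (p⊂q⇒∣p∣<∣q∣ ((λ x∈ → ∈-tabulate⁺ (grow-⊇ R _ (∈-tabulate⁻ x∈))) ,
                                       i , ∈-tabulate⁺ g , ¬r ∘ ∈-tabulate⁻))

    closed-or-large : ∀ t → Closed (reached t) ⊎ t ≤ size (reached t)
    closed-or-large zero = inj₂ z≤n
    closed-or-large (suc t) with closed-or-large t
    ... | inj₁ cl = inj₁ (grow-closed cl)
    ... | inj₂ t≤ with closed-or-grows (reached t)
    ... | inj₁ cl = inj₁ (grow-closed cl)
    ... | inj₂ grows = inj₂ (≤-<-trans t≤ grows)

    reachable : V → Bool
    reachable = reached (suc N)

    reachable-closed : Closed reachable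
    reachable-closed with closed-or-large (suc N)
    ... | inj₁ cl = cl
    ... | inj₂ large = ⊥-elim (<-irrefl refl (≤-trans large (∣p∣≤n (tabulate (reachable ∘ to enum)))))

    start-reached : ∀ t → T (p c) → T (reached t c)
    start-reached zero pc with c ≟V c
    ... | yes _ = Equivalence.from T-∧ (pc , tt)
    ... | no c≢c = ⊥-elim (c≢c refl)
    start-reached (suc t) pc = grow-⊇ (reached t) c (start-reached t pc)

    reachable-complete : ∀ w → Reach (T ∘ p) c w → T (reachable w)
    reachable-complete w (here pc) = start-reached (suc N) pc
    reachable-complete w (step {b = x} r e pw) = reachable-closed w
      (Equivalence.from (T-∨ {reachable w})
        (inj₂ (Equivalence.from T-∧ (pw , fromWitness (x , reachable-complete x r , e)))))

  reachable : (p : V → Bool) → V → V → Bool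
  reachable = Search.reachable

  reachable⇔ : ∀ p c w → T (reachable p c w) ⇔ Reach (T ∘ p) c w
  reachable⇔ p c w = mk⇔ (Search.reached-sound p c (suc N) w) (Search.reachable-complete p c w)

  reachable-component : ∀ p c → T (p c) → IsComponent (T ∘ p) (reachable p c)
  reachable-component p c pc =
    (c , Equivalence.from (reachable⇔ p c c) (here pc)) ,
    λ c′ rc′ w → mk⇔ (λ rw → Reach-trans (Reach-sym (Equivalence.to (reachable⇔ p c c′) rc′))
                                          (Equivalence.to (reachable⇔ p c w) rw))
                     (λ r → Equivalence.from (reachable⇔ p c w)
                                             (Reach-trans (Equivalence.to (reachable⇔ p c c′) rc′) r))

  subset-size : (D : V → Bool) → Σ ℕ (HasSize D)
  subset-size D = Σ-finite (N , enum) (T-finite ∘ D)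

module G′ (n k : ℕ) (adj : Adjacency n) where
  open Construction n k adj public

  XIndex : Set
  XIndex = Σ (Fin n) λ i → Σ (Fin k) λ j → Σ (Fin n) (NB i)

  XIndex-finite : Finite XIndex
  XIndex-finite = Σ-finite Fin-finite λ _ → Σ-finite Fin-finite λ _ → Σ-finite Fin-finite (T-finite ∘ closedN adj _)

  Code : Set
  Code = (Fin k × Fin n × Fin n) ⊎ (Fin k × Fin n × Fin (k' ∸ n + 1)) ⊎ Fin n ⊎
         Σ (Fin n) (λ i → Fin (k' ∸ k * suc (deg adj i))) ⊎ XIndex ⊎ XIndex ⊎ (XIndex × Fin (k' ∸ 1)) ⊎ ⊤

  Code-finite : Finite Code
  Code-finite = ⊎-finite (Σ-finite Fin-finite λ _ → Σ-finite Fin-finite λ _ → Fin-finite)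
              (⊎-finite (Σ-finite Fin-finite λ _ → Σ-finite Fin-finite λ _ → Fin-finite)
              (⊎-finite Fin-finite
              (⊎-finite (Σ-finite Fin-finite λ _ → Fin-finite)
              (⊎-finite XIndex-finite (⊎-finite XIndex-finite
              (⊎-finite (Σ-finite XIndex-finite λ _ → Fin-finite) ⊤-finite))))))

  decode : Code → V'
  decode (inj₁ (j , b , a)) = line j b a
  decode (inj₂ (inj₁ (j , b , t))) = bpend j b t
  decode (inj₂ (inj₂ (inj₁ i))) = zv i
  decode (inj₂ (inj₂ (inj₂ (inj₁ (i , t))))) = wpend i t
  decode (inj₂ (inj₂ (inj₂ (inj₂ (inj₁ (i , j , w , h)))))) = xv i j w h
  decode (inj₂ (inj₂ (inj₂ (inj₂ (inj₂ (inj₁ (i , j , w , h))))))) = yv i j w h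
  decode (inj₂ (inj₂ (inj₂ (inj₂ (inj₂ (inj₂ (inj₁ ((i , j , w , h) , t)))))))) = qpend i j w h t
  decode (inj₂ (inj₂ (inj₂ (inj₂ (inj₂ (inj₂ (inj₂ tt))))))) = uv

  encode : V' → Code
  encode (line j b a) = inj₁ (j , b , a)
  encode (bpend j b t) = inj₂ (inj₁ (j , b , t))
  encode (zv i) = inj₂ (inj₂ (inj₁ i))
  encode (wpend i t) = inj₂ (inj₂ (inj₂ (inj₁ (i , t))))
  encode (xv i j w h) = inj₂ (inj₂ (inj₂ (inj₂ (inj₁ (i , j , w , h)))))
  encode (yv i j w h) = inj₂ (inj₂ (inj₂ (inj₂ (inj₂ (inj₁ (i , j , w , h))))))
  encode (qpend i j w h t) = inj₂ (inj₂ (inj₂ (inj₂ (inj₂ (inj₂ (inj₁ ((i , j , w , h) , t)))))))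
  encode uv = inj₂ (inj₂ (inj₂ (inj₂ (inj₂ (inj₂ (inj₂ tt))))))

  decode-encode : ∀ v → decode (encode v) ≡ v
  decode-encode (line j b a) = refl
  decode-encode (bpend j b t) = refl
  decode-encode (zv i) = refl
  decode-encode (wpend i t) = refl
  decode-encode (xv i j w h) = refl
  decode-encode (yv i j w h) = refl
  decode-encode (qpend i j w h t) = refl
  decode-encode uv = refl

  encode-decode : ∀ x → encode (decode x) ≡ x
  encode-decode (inj₁ (j , b , a)) = refl
  encode-decode (inj₂ (inj₁ (j , b , t))) = refl
  encode-decode (inj₂ (inj₂ (inj₁ i))) = refl
  encode-decode (inj₂ (inj₂ (inj₂ (inj₁ (i , t))))) = refl
  encode-decode (inj₂ (inj₂ (inj₂ (inj₂ (inj₁ (i , j , w , h)))))) = refl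
  encode-decode (inj₂ (inj₂ (inj₂ (inj₂ (inj₂ (inj₁ (i , j , w , h))))))) = refl
  encode-decode (inj₂ (inj₂ (inj₂ (inj₂ (inj₂ (inj₂ (inj₁ ((i , j , w , h) , t)))))))) = refl
  encode-decode (inj₂ (inj₂ (inj₂ (inj₂ (inj₂ (inj₂ (inj₂ tt))))))) = refl

  V′-finite : Finite V'
  V′-finite = _ , ↔-trans (proj₂ Code-finite) (mk↔ₛ′ decode encode decode-encode encode-decode)

  CycSucc? : ∀ p q → Dec (CycSucc p q)
  CycSucc? p q = (suc p ≟ℕ q) ⊎-dec ((suc p ≟ℕ n * n) ×-dec ((q ≟ℕ 0) ×-dec ¬? (p ≟ℕ q)))

  E0? : ∀ a b → Dec (E0 a b)
  E0? (line j₁ b₁ a₁) (line j₂ b₂ a₂) with j₁ ≟ j₂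
  ... | no ne = no λ { (cyc _ _ _ _ _ _) → ne refl }
  ... | yes refl = map′ (cyc j₁ b₁ a₁ b₂ a₂) (λ { (cyc _ _ _ _ _ c) → c }) (CycSucc? _ _)
  E0? (line j₁ b₁ a₁) (bpend j₂ b₂ t₂) with j₁ ≟ j₂ | b₁ ≟ b₂ | toℕ a₁ ≟ℕ 0
  ... | no ne | _ | _ = no λ { (bE _ _ _ _ _) → ne refl }
  ... | yes _ | no ne | _ = no λ { (bE _ _ _ _ _) → ne refl }
  ... | yes _ | yes _ | no ne = no λ { (bE _ _ _ e _) → ne e }
  ... | yes refl | yes refl | yes e = yes (bE j₁ b₁ a₁ e t₂)
  E0? (line _ _ _) (zv _) = no λ ()
  E0? (line _ _ _) (wpend _ _) = no λ ()
  E0? (line _ _ _) (xv _ _ _ _) = no λ ()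
  E0? (line _ _ _) (yv _ _ _ _) = no λ ()
  E0? (line _ _ _) (qpend _ _ _ _ _) = no λ ()
  E0? (line _ _ _) uv = no λ ()
  E0? (bpend _ _ _) _ = no λ ()
  E0? (zv _) (line _ _ _) = no λ ()
  E0? (zv _) (bpend _ _ _) = no λ ()
  E0? (zv _) (zv _) = no λ ()
  E0? (zv i₁) (wpend i₂ t₂) with i₁ ≟ i₂
  ... | no ne = no λ { (wE _ _) → ne refl }
  ... | yes refl = yes (wE i₁ t₂)
  E0? (zv _) (xv _ _ _ _) = no λ ()
  E0? (zv i₁) (yv i₂ j₂ w₂ h₂) with i₁ ≟ i₂
  ... | no ne = no λ { (zyE _ _ _ _) → ne refl }
  ... | yes refl = yes (zyE i₁ j₂ w₂ h₂)
  E0? (zv _) (qpend _ _ _ _ _) = no λ ()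
  E0? (zv _) uv = no λ ()
  E0? (wpend _ _) _ = no λ ()
  E0? (xv i₁ j₁ w₁ h₁) (line j₂ b₂ a₂) with j₁ ≟ j₂ | i₁ ≟ b₂ | w₁ ≟ a₂
  ... | no ne | _ | _ = no λ { (xlE _ _ _ _) → ne refl }
  ... | yes _ | no ne | _ = no λ { (xlE _ _ _ _) → ne refl }
  ... | yes _ | yes _ | no ne = no λ { (xlE _ _ _ _) → ne refl }
  ... | yes refl | yes refl | yes refl = yes (xlE i₁ j₁ w₁ h₁)
  E0? (xv _ _ _ _) (bpend _ _ _) = no λ ()
  E0? (xv _ _ _ _) (zv _) = no λ ()
  E0? (xv _ _ _ _) (wpend _ _) = no λ ()
  E0? (xv _ _ _ _) (xv _ _ _ _) = no λ ()
  E0? (xv i₁ j₁ w₁ h₁) (yv i₂ j₂ w₂ h₂) with i₁ ≟ i₂ | j₁ ≟ j₂ | w₁ ≟ w₂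
  ... | no ne | _ | _ = no λ { (xyE _ _ _ _) → ne refl }
  ... | yes _ | no ne | _ = no λ { (xyE _ _ _ _) → ne refl }
  ... | yes _ | yes _ | no ne = no λ { (xyE _ _ _ _) → ne refl }
  ... | yes refl | yes refl | yes refl =
    yes (subst (λ h → E0 (xv i₁ j₁ w₁ h₁) (yv i₁ j₁ w₁ h)) (T-irrelevant h₁ h₂) (xyE i₁ j₁ w₁ h₁))
  E0? (xv i₁ j₁ w₁ h₁) (qpend i₂ j₂ w₂ h₂ t₂) with i₁ ≟ i₂ | j₁ ≟ j₂ | w₁ ≟ w₂
  ... | no ne | _ | _ = no λ { (xqE _ _ _ _ _) → ne refl }
  ... | yes _ | no ne | _ = no λ { (xqE _ _ _ _ _) → ne refl }
  ... | yes _ | yes _ | no ne = no λ { (xqE _ _ _ _ _) → ne refl }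
  ... | yes refl | yes refl | yes refl =
    yes (subst (λ h → E0 (xv i₁ j₁ w₁ h₁) (qpend i₁ j₁ w₁ h t₂)) (T-irrelevant h₁ h₂) (xqE i₁ j₁ w₁ h₁ t₂))
  E0? (xv _ _ _ _) uv = no λ ()
  E0? (yv _ _ _ _) _ = no λ ()
  E0? (qpend _ _ _ _ _) _ = no λ ()
  E0? uv (line _ _ _) = yes (uE _ (λ ()))
  E0? uv (bpend _ _ _) = yes (uE _ (λ ()))
  E0? uv (zv _) = yes (uE _ (λ ()))
  E0? uv (wpend _ _) = yes (uE _ (λ ()))
  E0? uv (xv _ _ _ _) = yes (uE _ (λ ()))
  E0? uv (yv _ _ _ _) = yes (uE _ (λ ()))
  E0? uv (qpend _ _ _ _ _) = yes (uE _ (λ ()))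
  E0? uv uv = no λ { (uE _ ne) → ne refl }

  open Reachability Edge (λ a b → E0? a b ⊎-dec E0? b a) swap (proj₂ V′-finite) public

module Layout {m k : ℕ} (k≥1 : 1 ≤ k) (adj : Adjacency (suc (suc m))) (irreflexive : ∀ i → adj i i ≡ false) where

  n₀ : ℕ
  n₀ = suc m

  n : ℕ
  n = suc n₀

  open G′ n k adj public

  -- positions on a block are handled as naturals; out-of-range positions are sent to 0
  clamp : ℕ → Fin n
  clamp t with t ≤? n₀
  ... | yes t≤n₀ = fromℕ< (s≤s t≤n₀)
  ... | no _ = zero

  toℕ-clamp : ∀ {t} → t < n → toℕ (clamp t) ≡ t
  toℕ-clamp {t} t<n with t ≤? n₀
  ... | yes t≤n₀ = toℕ-fromℕ< (s≤s t≤n₀)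
  ... | no t≰n₀ = ⊥-elim (t≰n₀ (s≤s⁻¹ t<n))

  clamp-toℕ : ∀ a → clamp (toℕ a) ≡ a
  clamp-toℕ a = toℕ-injective (toℕ-clamp (toℕ<n a))

  clamp-injective : ∀ {s t} → s < n → t < n → clamp s ≡ clamp t → s ≡ t
  clamp-injective s<n t<n e = trans (sym (toℕ-clamp s<n)) (trans (cong toℕ e) (toℕ-clamp t<n))

  0<n : 0 < n
  0<n = s≤s z≤n

  n₀<n : n₀ < n
  n₀<n = n<1+n n₀

  block-edge : ∀ j b {t} → suc t < n → E0 (line j b (clamp t)) (line j b (clamp (suc t)))
  block-edge j b {t} t+1<n = cyc j b _ b _ (inj₁ (begin
    suc (toℕ b * n + toℕ (clamp t))    ≡⟨ cong (λ r → suc (toℕ b * n + r)) (toℕ-clamp (<-trans (n<1+n t) t+1<n)) ⟩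
    suc (toℕ b * n + t)                ≡⟨ sym (+-suc _ t) ⟩
    toℕ b * n + suc t                  ≡⟨ cong (toℕ b * n +_) (sym (toℕ-clamp t+1<n)) ⟩
    toℕ b * n + toℕ (clamp (suc t))    ∎))
    where open ≡-Reasoning

  block-boundary : ∀ j {c} → suc c < n → E0 (line j (clamp c) (clamp n₀)) (line j (clamp (suc c)) (clamp 0))
  block-boundary j {c} c+1<n = cyc j _ _ _ _ (inj₁ (begin
    suc (toℕ (clamp c) * n + toℕ (clamp n₀))  ≡⟨ cong₂ (λ x y → suc (x * n + y)) (toℕ-clamp c<n) (toℕ-clamp n₀<n) ⟩
    suc (c * n + n₀)                           ≡⟨ cong suc (+-comm (c * n) n₀) ⟩
    suc c * n                                  ≡⟨ sym (+-identityʳ _) ⟩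
    suc c * n + 0                              ≡⟨ cong₂ (λ x y → x * n + y) (sym (toℕ-clamp c+1<n)) (sym (toℕ-clamp 0<n)) ⟩
    toℕ (clamp (suc c)) * n + toℕ (clamp 0)    ∎))
    where
    open ≡-Reasoning
    c<n : c < n
    c<n = <-trans (n<1+n c) c+1<n

  wrap-edge : ∀ j → E0 (line j (clamp n₀) (clamp n₀)) (line j (clamp 0) (clamp 0))
  wrap-edge j = cyc j _ _ _ _ (inj₂ (trans (cong suc last≡) (cong suc (+-comm (n₀ * n) n₀)) , first≡0 , last≢first))
    where
    last≡ : toℕ (clamp n₀) * n + toℕ (clamp n₀) ≡ n₀ * n + n₀
    last≡ = cong₂ (λ x y → x * n + y) (toℕ-clamp n₀<n) (toℕ-clamp n₀<n)
    first≡0 : toℕ (clamp 0) * n + toℕ (clamp 0) ≡ 0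
    first≡0 = cong₂ (λ x y → x * n + y) (toℕ-clamp 0<n) (toℕ-clamp 0<n)
    last≢first : toℕ (clamp n₀) * n + toℕ (clamp n₀) ≢ toℕ (clamp 0) * n + toℕ (clamp 0)
    last≢first e with trans (sym last≡) (trans e first≡0)
    ... | ()

  walk-block : ∀ {P : V' → Set} j b {s t} → s ≤′ t → t < n →
               (∀ r → s ≤ r → r ≤ t → P (line j b (clamp r))) → Reach P (line j b (clamp s)) (line j b (clamp t))
  walk-block j b (≤′-reflexive refl) _ allP = here (allP _ ≤-refl ≤-refl)
  walk-block j b {s} (≤′-step {t} s≤′t) t+1<n allP =
    step (walk-block j b s≤′t (<-trans (n<1+n t) t+1<n) λ r s≤r r≤t → allP r s≤r (m≤n⇒m≤1+n r≤t))
         (inj₁ (block-edge j b t+1<n))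
         (allP (suc t) (≤′⇒≤ (≤′-step s≤′t)) ≤-refl)

  walk-from-start : ∀ {P : V' → Set} j b a → (∀ r → r ≤ toℕ a → P (line j b (clamp r))) →
                    Reach P (line j b (clamp 0)) (line j b a)
  walk-from-start j b a allP = subst (Reach _ _ ∘ line j b) (clamp-toℕ a)
    (walk-block j b (≤⇒≤′ z≤n) (toℕ<n a) λ r _ → allP r)

  to-hub : ∀ {P : V' → Set} {c} → P c → P uv → Reach P c uv
  to-hub {c = uv} pc _ = here pc
  to-hub {c = line _ _ _} pc pu = step (here pc) (inj₂ (uE _ λ ())) pu
  to-hub {c = bpend _ _ _} pc pu = step (here pc) (inj₂ (uE _ λ ())) pu
  to-hub {c = zv _} pc pu = step (here pc) (inj₂ (uE _ λ ())) pu
  to-hub {c = wpend _ _} pc pu = step (here pc) (inj₂ (uE _ λ ())) pu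
  to-hub {c = xv _ _ _ _} pc pu = step (here pc) (inj₂ (uE _ λ ())) pu
  to-hub {c = yv _ _ _ _} pc pu = step (here pc) (inj₂ (uE _ λ ())) pu
  to-hub {c = qpend _ _ _ _ _} pc pu = step (here pc) (inj₂ (uE _ λ ())) pu

  via-hub : ∀ {P : V' → Set} {c w} → P c → P uv → P w → Reach P c w
  via-hub pc pu pw = Reach-trans (to-hub pc pu) (Reach-sym (to-hub pw pu))

  NB↔ : ∀ i → Fin (suc (deg adj i)) ↔ Σ (Fin n) (NB i)
  NB↔ i = subst (λ d → Fin d ↔ Σ (Fin n) (NB i))
                (∣tabulate-insert∣ i (adj i) (irreflexive i)) (count↔Σ (closedN adj i))

  -- opaque: unfolding it while comparing families of y-vertices makes type checking explode
  opaque
    Y↔ : ∀ i → Fin (k * suc (deg adj i)) ↔ (Fin k × Σ (Fin n) (NB i))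
    Y↔ i = ↔-trans *↔× (↔-refl ×-↔ NB↔ i)

  XIndex↔ : Fin (vsum (tabulate λ i → k * suc (deg adj i))) ↔ XIndex
  XIndex↔ = ↔-trans (sum↔Σ _) (Σ-↔ ↔-refl (Y↔ _))

  -- The parts of G′: the hub u, the regions (block b of line j with B^j_b) and the units
  -- ({x, y} ∪ Q_x); they are disjoint, and by the choice of k′ there are exactly k′ of them.
  Part : Set
  Part = ⊤ ⊎ (Fin k × Fin n) ⊎ XIndex

  pattern hub = inj₁ tt
  pattern region j b = inj₂ (inj₁ (j , b))
  pattern unit x = inj₂ (inj₂ x)

  k′↔Part : Fin k' ↔ Part
  k′↔Part = ↔-trans (+↔⊎ {1}) (1↔⊤ ⊎-↔ ↔-trans +↔⊎ (*↔× ⊎-↔ XIndex↔))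

  n≤k′ : n ≤ k'
  n≤k′ = ≤-trans (≤-trans (≤-reflexive (sym (*-identityˡ n))) (*-monoˡ-≤ n k≥1))
                 (≤-trans (m≤m+n _ _) (n≤1+n _))

  n+[k′∸n+1]≡1+k′ : n + (k' ∸ n + 1) ≡ suc k'
  n+[k′∸n+1]≡1+k′ = trans (sym (+-assoc n (k' ∸ n) 1)) (trans (cong (_+ 1) (m+[n∸m]≡n n≤k′)) (+-comm k' 1))

  y-count≤k′ : ∀ i → k * suc (deg adj i) ≤ k'
  y-count≤k′ i = ≤-trans (term≤sum (λ i → k * suc (deg adj i)) i) (≤-trans (m≤n+m _ (k * n)) (n≤1+n _))

  part : V' → Maybe Part
  part uv = just hub
  part (line j b _) = just (region j b)
  part (bpend j b _) = just (region j b)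
  part (xv i j w h) = just (unit (i , j , w , h))
  part (yv i j w h) = just (unit (i , j , w , h))
  part (qpend i j w h _) = just (unit (i , j , w , h))
  part (zv _) = nothing
  part (wpend _ _) = nothing

  position : V' → ℕ
  position (line _ _ a) = toℕ a
  position _ = 0

  position-< : ∀ v → position v < n
  position-< (line _ _ a) = toℕ<n a
  position-< (bpend _ _ _) = s≤s z≤n
  position-< (zv _) = s≤s z≤n
  position-< (wpend _ _) = s≤s z≤n
  position-< (xv _ _ _ _) = s≤s z≤n
  position-< (yv _ _ _ _) = s≤s z≤n
  position-< (qpend _ _ _ _ _) = s≤s z≤n
  position-< uv = s≤s z≤n

  unit-family : XIndex → Fin (suc k') → V'
  unit-family (i , j , w , h) = single (xv i j w h) ⊕ single (yv i j w h) ⊕ qpend i j w h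

  unit-family-injective : ∀ x → Injective _≡_ _≡_ (unit-family x)
  unit-family-injective (i , j , w , h) =
    ⊕-injective {a = 1} (single-injective _)
      (⊕-injective {a = 1} (single-injective _) (λ { refl → refl }) λ _ _ ())
      (λ _ → ⊕-all {a = 1} (xv i j w h ≢_) (λ _ ()) λ _ ())

  unit-family-part : ∀ x t → part (unit-family x t) ≡ just (unit x)
  unit-family-part x = ⊕-all {a = 1} in-unit (λ _ → refl) (⊕-all {a = 1} in-unit (λ _ → refl) λ _ → refl)
    where
    in-unit : V' → Set
    in-unit v = part v ≡ just (unit x)

  two-units-injective : ∀ {x₀ x₁} → x₀ ≢ x₁ → Injective _≡_ _≡_ (unit-family x₀ ⊕ unit-family x₁)
  two-units-injective {x₀} {x₁} x₀≢x₁ =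
    ⊕-injective (unit-family-injective x₀) (unit-family-injective x₁) λ s t e →
      x₀≢x₁ (just-unit-injective (trans (sym (unit-family-part x₀ s))
                                  (trans (cong part e) (unit-family-part x₁ t))))
    where
    just-unit-injective : ∀ {x y} → just (unit x) ≡ just (unit y) → x ≡ y
    just-unit-injective refl = refl

  y-family : ∀ i → Fin (k * suc (deg adj i)) → V'
  y-family i t = yv i (proj₁ (to (Y↔ i) t)) (proj₁ (proj₂ (to (Y↔ i) t))) (proj₂ (proj₂ (to (Y↔ i) t)))

  y-family-injective : ∀ i → Injective _≡_ _≡_ (y-family i)
  y-family-injective i e = Injection.injective (↔⇒↣ (Y↔ i)) (yv-injective _ _ e)
    where
    yv-injective : ∀ (p q : Fin k × Σ (Fin n) (NB i)) →
                   yv i (proj₁ p) (proj₁ (proj₂ p)) (proj₂ (proj₂ p)) ≡ yv i (proj₁ q) (proj₁ (proj₂ q)) (proj₂ (proj₂ q)) →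
                   p ≡ q
    yv-injective _ _ refl = refl

  z-family : ∀ i → Fin (1 + ((k' ∸ k * suc (deg adj i)) + k * suc (deg adj i))) → V'
  z-family i = single (zv i) ⊕ wpend i ⊕ y-family i

  z-family-injective : ∀ i → Injective _≡_ _≡_ (z-family i)
  z-family-injective i = ⊕-injective {a = 1} (single-injective _)
    (⊕-injective (λ { refl → refl }) (y-family-injective i) λ _ _ ())
    λ _ → ⊕-all {a = k' ∸ k * suc (deg adj i)} (zv i ≢_) (λ _ ()) λ _ ()

  line-injective : ∀ {j j′ b b′ a a′} → line j b a ≡ line j′ b′ a′ → b ≡ b′ × a ≡ a′
  line-injective refl = refl , refl

  +toℕ<n : ∀ {v} (t : Fin (n ∸ v)) → v ≤ n → v + toℕ t < n
  +toℕ<n {v} t v≤n = <-≤-trans (+-monoʳ-< v (toℕ<n t)) (≤-reflexive (m+[n∸m]≡n v≤n))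

  block-tail : Fin k → Fin n → (v : ℕ) → Fin (n ∸ v) → V'
  block-tail j b v t = line j b (clamp (v + toℕ t))

  block-head : Fin k → Fin n → (v : ℕ) → Fin v → V'
  block-head j b v t = line j b (clamp (toℕ t))

  block-tail-injective : ∀ {j b v} → v ≤ n → Injective _≡_ _≡_ (block-tail j b v)
  block-tail-injective {v = v} v≤n e = toℕ-injective
    (+-cancelˡ-≡ v _ _ (clamp-injective (+toℕ<n _ v≤n) (+toℕ<n _ v≤n) (proj₂ (line-injective e))))

  block-head-injective : ∀ {j b v} → v ≤ n → Injective _≡_ _≡_ (block-head j b v)
  block-head-injective v≤n e = toℕ-injective
    (clamp-injective (<-≤-trans (toℕ<n _) v≤n) (<-≤-trans (toℕ<n _) v≤n) (proj₂ (line-injective e)))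

  boundary-family : Fin k → Fin n → Fin n → (v : ℕ) → Fin ((n ∸ v) + (v + (k' ∸ n + 1))) → V'
  boundary-family j b b⁺ v = block-tail j b v ⊕ block-head j b⁺ v ⊕ bpend j b⁺

  boundary-family-injective : ∀ {j b b⁺ v} → b ≢ b⁺ → v ≤ n → Injective _≡_ _≡_ (boundary-family j b b⁺ v)
  boundary-family-injective {j} {b} {b⁺} {v} b≢b⁺ v≤n =
    ⊕-injective {a = n ∸ v} (block-tail-injective v≤n)
      (⊕-injective {a = v} (block-head-injective v≤n) (λ { refl → refl }) λ _ _ ())
      λ s → ⊕-all {a = v} (block-tail j b v s ≢_) (λ _ e → b≢b⁺ (proj₁ (line-injective e))) λ _ ()

  k′<∣boundary-family∣ : ∀ {v} → v ≤ n → k' < (n ∸ v) + (v + (k' ∸ n + 1))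
  k′<∣boundary-family∣ {v} v≤n = ≤-reflexive (begin
    suc k'                          ≡⟨ sym n+[k′∸n+1]≡1+k′ ⟩
    n + (k' ∸ n + 1)                ≡⟨ cong (_+ (k' ∸ n + 1)) (sym (m∸n+n≡m v≤n)) ⟩
    (n ∸ v) + v + (k' ∸ n + 1)      ≡⟨ +-assoc (n ∸ v) v _ ⟩
    (n ∸ v) + (v + (k' ∸ n + 1))    ∎)
    where open ≡-Reasoning

  ∣∁S∣≥k′+2 : ∀ {S : V' → Bool} {d} → HasSize S k' → HasSize (not ∘ S) d → suc (suc k') ≤ d
  ∣∁S∣≥k′+2 {S} {d} |S| |∁S| = +-cancelˡ-≤ k' _ _ (begin
    k' + suc (suc k')     ≡⟨ +-suc k' (suc k') ⟩
    suc k' + suc k'       ≤⟨ injection⇒≤ ↔-refl (proj₂ V′-finite) (mk↣ (two-units-injective x₀≢x₁)) ⟩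
    proj₁ V′-finite       ≤⟨ ≤-partition S (proj₂ V′-finite) |S| |∁S| ⟩
    k' + d                ∎)
    where
    open ≤-Reasoning
    j₀ : Fin k
    j₀ = fromℕ< k≥1
    x₀≢x₁ : (zero , j₀ , zero , closedN-refl adj zero) ≢ (suc zero , j₀ , suc zero , closedN-refl adj (suc zero))
    x₀≢x₁ ()

  module SafeSet (S : V' → Bool) (|S| : HasSize S k') (safe : IsSafeSet S) where

    ∉S : V' → Set
    ∉S v = T (not (S v))

    hub∈S : T (S uv)
    hub∈S with T? (S uv)
    ... | yes u∈S = u∈S
    ... | no u∉S = ⊥-elim (proj₂ safe C (not ∘ S) c d (reachable-component S s s∈S) ∁S-component C-joined |C| |∁S| c<d)
      where
      s : V'
      s = proj₁ (proj₁ safe)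
      s∈S : T (S s)
      s∈S = proj₂ (proj₁ safe)
      C : V' → Bool
      C = reachable S s
      c : ℕ
      c = proj₁ (subset-size C)
      |C| : HasSize C c
      |C| = proj₂ (subset-size C)
      d : ℕ
      d = proj₁ (subset-size (not ∘ S))
      |∁S| : HasSize (not ∘ S) d
      |∁S| = proj₂ (subset-size (not ∘ S))
      ∁S-component : IsComponent ∉S (not ∘ S)
      ∁S-component = (uv , not-T⁺ u∉S) , λ _ c∉S _ → mk⇔ (via-hub c∉S (not-T⁺ u∉S)) Reach-target
      C-joined : Joined C (not ∘ S)
      C-joined = s , uv , Equivalence.from (reachable⇔ S s s) (here s∈S) , not-T⁺ u∉S ,
                 inj₂ (uE s λ { refl → u∉S s∈S })
      c≤k′ : c ≤ k'
      c≤k′ = subset-≤ |C| |S| λ w Cw → Reach-target (Equivalence.to (reachable⇔ S s w) Cw)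
      c<d : c < d
      c<d = ≤-trans (s≤s (m≤n⇒m≤1+n c≤k′)) (∣∁S∣≥k′+2 |S| |∁S|)

    S-component : IsComponent (T ∘ S) S
    S-component = (uv , hub∈S) , λ _ c∈S _ → mk⇔ (via-hub c∈S hub∈S) Reach-target

    -- S is connected through u, so the safe-set condition bounds every component of G′ − S by k′
    reach-≤k′ : ∀ {r} v → ∉S v → (g : Fin r → V') → Injective _≡_ _≡_ g → (∀ i → Reach ∉S v (g i)) → r ≤ k'
    reach-≤k′ {r} v v∉S g g-inj reaches = ≤-trans r≤d d≤k′
      where
      D : V' → Bool
      D = reachable (not ∘ S) v
      d : ℕ
      d = proj₁ (subset-size D)
      |D| : HasSize D d
      |D| = proj₂ (subset-size D)
      D-joined : Joined S D
      D-joined = uv , v , hub∈S , Equivalence.from (reachable⇔ (not ∘ S) v v) (here v∉S) ,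
                 inj₁ (uE v λ { refl → not-T⁻ v∉S hub∈S })
      d≤k′ : d ≤ k'
      d≤k′ = ≮⇒≥ {k'} {d} (proj₂ safe S D k' d S-component (reachable-component (not ∘ S) v v∉S) D-joined |S| |D|)
      into-D : Fin r → Σ V' (T ∘ D)
      into-D i = g i , Equivalence.from (reachable⇔ (not ∘ S) v (g i)) (reaches i)
      into-D-injective : Injective _≡_ _≡_ into-D
      into-D-injective e = g-inj (cong proj₁ e)
      r≤d : r ≤ d
      r≤d = injection⇒≤ {X = Fin r} {Y = Σ V' (T ∘ D)} ↔-refl |D| (mk↣ {to = into-D} into-D-injective)

    region-meets-S : ∀ j b → ∃ λ v → part v ≡ just (region j b) × T (S v)
    region-meets-S j b with any? (λ a → T? (S (line j b a))) | any? (λ t → T? (S (bpend j b t)))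
    ... | yes (a , a∈S) | _ = line j b a , refl , a∈S
    ... | no _ | yes (t , t∈S) = bpend j b t , refl , t∈S
    ... | no no-line | no no-pendant =
      ⊥-elim (<⇒≱ (≤-reflexive (sym n+[k′∸n+1]≡1+k′)) (reach-≤k′ start (line∉S _) family family-injective reached))
      where
      start : V'
      start = line j b (clamp 0)
      line∉S : ∀ a → ∉S (line j b a)
      line∉S a = not-T⁺ λ a∈S → no-line (a , a∈S)
      family : Fin (n + (k' ∸ n + 1)) → V'
      family = line j b ⊕ bpend j b
      family-injective : Injective _≡_ _≡_ family
      family-injective = ⊕-injective {a = n} (λ { refl → refl }) (λ { refl → refl }) λ _ _ ()
      reached : ∀ i → Reach ∉S start (family i)
      reached = ⊕-all {a = n} (Reach ∉S start) (λ a → walk-from-start j b a λ _ _ → line∉S _)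
        λ t → step (here (line∉S _)) (inj₁ (bE j b _ (toℕ-clamp 0<n) t)) (not-T⁺ λ t∈S → no-pendant (t , t∈S))

    unit-meets-S : ∀ x → ∃ λ v → part v ≡ just (unit x) × T (S v)
    unit-meets-S x@(i , j , w , h) with any? (λ t → T? (S (unit-family x t)))
    ... | yes (t , t∈S) = unit-family x t , unit-family-part x t , t∈S
    ... | no none = ⊥-elim (<⇒≱ ≤-refl (reach-≤k′ (xv i j w h) x∉S (unit-family x) (unit-family-injective x) reached))
      where
      ∉S-at : ∀ t → ∉S (unit-family x t)
      ∉S-at t = not-T⁺ λ t∈S → none (t , t∈S)
      x∉S : ∉S (xv i j w h)
      x∉S = ∉S-at zero
      reached : ∀ t → Reach ∉S (xv i j w h) (unit-family x t)
      reached zero = here x∉S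
      reached (suc zero) = step (here x∉S) (inj₁ (xyE i j w h)) (∉S-at (suc zero))
      reached (suc (suc t)) = step (here x∉S) (inj₁ (xqE i j w h t)) (∉S-at (suc (suc t)))

    -- opaque: only the statement is used, and unfolding the searches inside is very slow
    opaque
      part-meets-S : ∀ π → ∃ λ v → part v ≡ just π × T (S v)
      part-meets-S hub = uv , refl , hub∈S
      part-meets-S (region j b) = region-meets-S j b
      part-meets-S (unit x) = unit-meets-S x

    rep : Part → V'
    rep π = proj₁ (part-meets-S π)

    part-rep : ∀ π → part (rep π) ≡ just π
    part-rep π = proj₁ (proj₂ (part-meets-S π))

    rep∈S : ∀ π → T (S (rep π))
    rep∈S π = proj₂ (proj₂ (part-meets-S π))

    rep-in-S : Part → Σ V' (T ∘ S)
    rep-in-S π = rep π , rep∈S π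

    rep-in-S-injective : Injective _≡_ _≡_ rep-in-S
    rep-in-S-injective {π} {π′} e =
      just-injective (trans (sym (part-rep π)) (trans (cong (part ∘ proj₁) e) (part-rep π′)))

    -- k′ distinct representatives inside a set of size k′ exhaust it
    opaque
      rep-onto : ∀ {v} → T (S v) → ∃ λ π → rep π ≡ v
      rep-onto {v} v∈S = map₂ (cong proj₁)
        (injection-surjective {A = Part} {X = Σ V' (T ∘ S)} k′↔Part |S| rep-in-S rep-in-S-injective (Σ-T-≟ _≟V_) (v , v∈S))

    rep-unique : ∀ {v π} → T (S v) → part v ≡ just π → rep π ≡ v
    rep-unique {v} {π} v∈S pv = trans (cong rep π≡π′) rep≡v
      where
      π′ : Part
      π′ = proj₁ (rep-onto v∈S)
      rep≡v : rep π′ ≡ v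
      rep≡v = proj₂ (rep-onto v∈S)
      π≡π′ : π ≡ π′
      π≡π′ = just-injective (trans (sym pv) (trans (cong part (sym rep≡v)) (part-rep π′)))

    partless-∉S : ∀ {v} → part v ≡ nothing → ∉S v
    partless-∉S {v} pv = not-T⁺ λ v∈S → just≢nothing
      (trans (sym (part-rep (proj₁ (rep-onto v∈S)))) (trans (cong part (proj₂ (rep-onto v∈S))) pv))
      where
      just≢nothing : ∀ {π} → just π ≢ nothing
      just≢nothing ()

    some-y∈S : ∀ i → ∃ λ j → ∃ λ w → Σ (NB i w) λ h → T (S (yv i j w h))
    some-y∈S i with any? (λ t → T? (S (y-family i t)))
    ... | yes (t , y∈S) = _ , _ , _ , y∈S
    ... | no none = ⊥-elim (<⇒≱ (s≤s (≤-reflexive (sym (m∸n+n≡m (y-count≤k′ i)))))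
                               (reach-≤k′ (zv i) z∉S (z-family i) (z-family-injective i) reached))
      where
      z∉S : ∉S (zv i)
      z∉S = partless-∉S refl
      reached : ∀ t → Reach ∉S (zv i) (z-family i t)
      reached = ⊕-all {a = 1} (Reach ∉S (zv i)) (λ _ → here z∉S)
        (⊕-all {a = k' ∸ k * suc (deg adj i)} (Reach ∉S (zv i)) (λ t → step (here z∉S) (inj₁ (wE i t)) (partless-∉S refl))
          λ t → step (here z∉S) (inj₁ (zyE i _ _ _)) (not-T⁺ λ y∈S → none (t , y∈S)))

    y∈S⇒line∈S : ∀ {i j w h} → T (S (yv i j w h)) → T (S (line j i w))
    y∈S⇒line∈S {i} {j} {w} {h} y∈S with T? (S (line j i w))
    ... | yes l∈S = l∈S
    ... | no l∉S = ⊥-elim (<⇒≱ ≤-refl (reach-≤k′ (xv i j w h) x∉S family family-injective reached))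
      where
      unit-∉S : ∀ {v} → part v ≡ just (unit (i , j , w , h)) → v ≢ yv i j w h → ∉S v
      unit-∉S pv v≢y = not-T⁺ λ v∈S → v≢y (trans (sym (rep-unique v∈S pv)) (rep-unique y∈S refl))
      x∉S : ∉S (xv i j w h)
      x∉S = unit-∉S refl λ ()
      family : Fin (suc k') → V'
      family = single (xv i j w h) ⊕ single (line j i w) ⊕ qpend i j w h
      family-injective : Injective _≡_ _≡_ family
      family-injective = ⊕-injective {a = 1} (single-injective _)
        (⊕-injective {a = 1} (single-injective _) (λ { refl → refl }) λ _ _ ())
        λ _ → ⊕-all {a = 1} (xv i j w h ≢_) (λ _ ()) λ _ ()
      reached : ∀ t → Reach ∉S (xv i j w h) (family t)
      reached zero = here x∉S
      reached (suc zero) = step (here x∉S) (inj₁ (xlE i j w h)) (not-T⁺ l∉S)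
      reached (suc (suc t)) = step (here x∉S) (inj₁ (xqE i j w h t)) (unit-∉S refl λ ())

    val : Fin k → Fin n → ℕ
    val j b = position (rep (region j b))

    val-line : ∀ {j b a} → T (S (line j b a)) → val j b ≡ toℕ a
    val-line a∈S = cong position (rep-unique a∈S refl)

    line-∉S : ∀ {j b a} → toℕ a ≢ val j b → ∉S (line j b a)
    line-∉S a≢val = not-T⁺ λ a∈S → a≢val (sym (val-line a∈S))

    bpend-∉S : ∀ {j b t} → 0 < val j b → ∉S (bpend j b t)
    bpend-∉S 0<val = not-T⁺ λ t∈S → <-irrefl (sym (cong position (rep-unique t∈S refl))) 0<val

    -- Otherwise the whole boundary family for v = val j b⁺ lies in the component of G′ − S at the start of b⁺.
    val-≤-across : ∀ j b b⁺ → b ≢ b⁺ → E0 (line j b (clamp n₀)) (line j b⁺ (clamp 0)) → val j b⁺ ≤ val j b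
    val-≤-across j b b⁺ b≢b⁺ boundary with val j b⁺ ≤? val j b
    ... | yes ≤val = ≤val
    ... | no ≰val = ⊥-elim (<⇒≱ (k′<∣boundary-family∣ (<⇒≤ v⁺<n))
                                  (reach-≤k′ start (line∉S-before 0<v⁺) (boundary-family j b b⁺ v⁺)
                                             (boundary-family-injective b≢b⁺ (<⇒≤ v⁺<n)) reached))
      where
      v⁺ : ℕ
      v⁺ = val j b⁺
      v<v⁺ : val j b < v⁺
      v<v⁺ = ≰⇒> ≰val
      0<v⁺ : 0 < v⁺
      0<v⁺ = ≤-<-trans z≤n v<v⁺
      v⁺<n : v⁺ < n
      v⁺<n = position-< (rep (region j b⁺))
      start : V'
      start = line j b⁺ (clamp 0)
      line∉S-after : ∀ {r} → v⁺ ≤ r → r < n → ∉S (line j b (clamp r))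
      line∉S-after v⁺≤r r<n = line-∉S λ e → <-irrefl (toℕ-clamp r<n) (<-≤-trans (subst (_< v⁺) (sym e) v<v⁺) v⁺≤r)
      line∉S-before : ∀ {r} → r < v⁺ → ∉S (line j b⁺ (clamp r))
      line∉S-before r<v⁺ = line-∉S λ e → <-irrefl (trans (sym (toℕ-clamp (<-trans r<v⁺ v⁺<n))) e) r<v⁺
      reach-after : ∀ t → Reach ∉S start (block-tail j b v⁺ t)
      reach-after t = Reach-trans (step (here (line∉S-before 0<v⁺)) (inj₂ boundary) (line∉S-after (s≤s⁻¹ v⁺<n) n₀<n))
        (Reach-sym (walk-block j b (≤⇒≤′ (s≤s⁻¹ (+toℕ<n t (<⇒≤ v⁺<n)))) n₀<n
                                λ r v⁺+t≤r r≤n₀ → line∉S-after (≤-trans (m≤m+n v⁺ _) v⁺+t≤r) (s≤s r≤n₀)))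
      reach-before : ∀ t → Reach ∉S start (block-head j b⁺ v⁺ t)
      reach-before t = walk-block j b⁺ (≤⇒≤′ z≤n) (<-trans (toℕ<n t) v⁺<n)
                                  λ r _ r≤t → line∉S-before (≤-<-trans r≤t (toℕ<n t))
      reach-pendant : ∀ t → Reach ∉S start (bpend j b⁺ t)
      reach-pendant t = step (here (line∉S-before 0<v⁺)) (inj₁ (bE j b⁺ _ (toℕ-clamp 0<n) t)) (bpend-∉S 0<v⁺)
      reached : ∀ t → Reach ∉S start (boundary-family j b b⁺ v⁺ t)
      reached = ⊕-all {a = n ∸ v⁺} (Reach ∉S start) reach-after (⊕-all {a = v⁺} (Reach ∉S start) reach-before reach-pendant)

    val-antitone : ∀ j {c t} → c ≤′ t → t < n → val j (clamp t) ≤ val j (clamp c)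
    val-antitone j (≤′-reflexive refl) _ = ≤-refl
    val-antitone j (≤′-step {t} c≤′t) t+1<n =
      ≤-trans (val-≤-across j _ _ (λ e → <-irrefl (clamp-injective t<n t+1<n e) (n<1+n t)) (block-boundary j t+1<n))
              (val-antitone j c≤′t t<n)
      where
      t<n : t < n
      t<n = <-trans (n<1+n t) t+1<n

    val-constant : ∀ j b → val j b ≡ val j (clamp 0)
    val-constant j b = subst (λ b′ → val j b′ ≡ val j (clamp 0)) (clamp-toℕ b) (≤-antisym
      (val-antitone j (≤⇒≤′ z≤n) (toℕ<n b))
      (≤-trans (val-≤-across j _ _ (λ e → <-irrefl (sym (clamp-injective n₀<n 0<n e)) (s≤s z≤n)) (wrap-edge j))
               (val-antitone j (≤⇒≤′ (s≤s⁻¹ (toℕ<n b))) n₀<n)))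

    chosen : Fin k → Fin n
    chosen j = clamp (val j (clamp 0))

    line∈S⇒chosen : ∀ {j b a} → T (S (line j b a)) → a ≡ chosen j
    line∈S⇒chosen {j} {b} {a} a∈S = trans (sym (clamp-toℕ a)) (cong clamp (trans (sym (val-line a∈S)) (val-constant j b)))

    dominating-set : ∃[ K ] (IsDominatingSet adj K × ∣ K ∣ ≤ k)
    dominating-set = image chosen , dominated , ∣image∣≤ chosen
      where
      dominated : IsDominatingSet adj (image chosen)
      dominated i with some-y∈S i
      ... | j , w , h , y∈S = chosen j , ∈-image chosen j , subst (NB i) (line∈S⇒chosen (y∈S⇒line∈S y∈S)) h

full-dominates : ∀ {n} (adj : Adjacency n) → IsDominatingSet adj full
full-dominates adj v = v , ∈⊤ , closedN-refl adj v

-- N[v_i] is read off row i of adj both in G′ and in IsDominatingSet.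
lemma2 : (n k : ℕ) (adj : Adjacency n) →
         (∀ i j → adj i j ≡ adj j i) →
         (∀ i → adj i i ≡ false) →
         1 ≤ k →
         (S : Construction.V' n k adj → Bool) →
         Construction.HasSize n k adj S (kPrime n k adj) →
         Construction.IsSafeSet n k adj S →
         ∃[ K ] (IsDominatingSet adj K × ∣ K ∣ ≤ k)
lemma2 n k adj _ _ _ _ _ _ with n ≤? k
... | yes n≤k = full , full-dominates adj , subst (_≤ k) (sym (∣⊤∣≡n n)) n≤k
lemma2 (suc (suc m)) k adj _ irreflexive k≥1 S |S| safe | no _ =
  Layout.SafeSet.dominating-set k≥1 adj irreflexive S |S| safe
lemma2 (suc zero) k adj _ _ k≥1 _ _ _ | no 1≰k = ⊥-elim (1≰k k≥1)
lemma2 zero k adj _ _ _ _ _ _ | no 0≰k = ⊥-elim (0≰k z≤n)
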